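{- Let $G$ be a finite simple $r$-regular graph with $n$ vertices, where $r\ge 1$. Then $\chi_2(G)-\chi(G)\le 2\lceil \frac{n}{r}\rceil-2$.
   Context: $\chi(G)$ is the chromatic number of $G$. A dynamic coloring of $G$ is a proper vertex coloring such that for every vertex $v$ of degree at least $2$, the neighbours of $v$ receive at least two different colors; $\chi_2(G)$ is the smallest number of colors in a dynamic coloring of $G$. -}

module Defs where

open import Data.Nat using (ℕ; zero; suc; _+_; _*_; _∸_; _≤_; _/_; NonZero)
open import Data.Bool using (Bool; true; false; T)
open import Data.Fin using (Fin)
open import Data.List using (length; filter; allFin)
open import Data.Product using (Σ; _×_; ∃-syntax)
open import Relation.Nullary using (¬_)
open import Relation.Nullary.Decidable using (Dec)
open import Data.Bool using (T?)
open import Relation.Binary.PropositionalEquality using (_≡_; _≢_)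

record Graph (n : ℕ) : Set where
  field
    adj      : Fin n → Fin n → Bool
    symmetric : ∀ u v → adj u v ≡ adj v u
    irreflexive : ∀ v → adj v v ≡ false

open Graph public

Adj : ∀ {n} → Graph n → Fin n → Fin n → Set
Adj G u v = T (adj G u v)

degree : ∀ {n} → Graph n → Fin n → ℕ
degree {n} G v = length (filter (λ u → T? (adj G v u)) (allFin n))

Regular : ∀ {n} → ℕ → Graph n → Set
Regular r G = ∀ v → degree G v ≡ r

ProperColoring : ∀ {n} → Graph n → (k : ℕ) → (Fin n → Fin k) → Set
ProperColoring G k c = ∀ u v → Adj G u v → c u ≢ c v

DynamicColoring : ∀ {n} → Graph n → (k : ℕ) → (Fin n → Fin k) → Set
DynamicColoring G k c =
  ProperColoring G k c ×
  (∀ v → 2 ≤ degree G v → ∃[ u ] ∃[ w ] (Adj G v u × Adj G v w × c u ≢ c w))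

Colorable : ∀ {n} → Graph n → ℕ → Set
Colorable {n} G k = ∃[ c ] ProperColoring {n} G k c

DynColorable : ∀ {n} → Graph n → ℕ → Set
DynColorable {n} G k = ∃[ c ] DynamicColoring {n} G k c

IsChromaticNumber : ∀ {n} → Graph n → ℕ → Set
IsChromaticNumber G k = Colorable G k × (∀ m → Colorable G m → k ≤ m)

IsDynamicChromaticNumber : ∀ {n} → Graph n → ℕ → Set
IsDynamicChromaticNumber G k = DynColorable G k × (∀ m → DynColorable G m → k ≤ m)

⌈_/_⌉ : (a b : ℕ) .{{_ : NonZero b}} → ℕ
⌈ a / b ⌉ = (a + (b ∸ 1)) / b

-- Start from an optimal proper colouring c; only vertices whose neighbours
-- all share one c-colour ("monochromatic") violate the dynamic condition.
-- Greedily choose monochromatic s₀ … s_{m-1} with pairwise disjoint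
-- neighbourhoods such that every monochromatic vertex shares a neighbour
-- with some sᵢ, and recolour N(sᵢ) with two fresh colours 2i, 2i+1 (the
-- first only for one anchor neighbour). Equal new colours force equal old
-- colours, so the result is proper; a monochromatic v meeting N(sᵢ) now sees
-- two colours, since either N(v) leaves N(sᵢ) or, by regularity,
-- N(v) = N(sᵢ). Disjointness gives m·r ≤ n, and m·r < n unless the old
-- colours are no longer needed; arithmetic with ⌈n/r⌉ finishes the proof.
module Submission where

open import Data.Bool using (Bool; true; false; T; T?; _∨_; if_then_else_)
open import Data.Empty using (⊥; ⊥-elim)
open import Data.Fin using (Fin; zero; suc; toℕ; fromℕ<; _≟_)
open import Data.Fin.Properties using (any?; all?; ¬∀⟶∃¬; toℕ-injective; toℕ-fromℕ<; toℕ<n)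
open import Data.List using (List; []; _∷_; length; filter; allFin)
open import Data.Bool.ListAction using (any)
open import Data.List.Properties using (length-tabulate)
open import Data.List.Membership.Propositional using (_∈_; find; lose)
open import Data.List.Membership.Propositional.Properties using (∈-allFin; ∈-filter⁻)
open import Data.List.Relation.Unary.Any as Any using (Any; here; there)
open import Data.List.Relation.Unary.Any.Properties using (any⁻)
open import Data.List.Relation.Unary.All as All using (All; []; _∷_)
open import Data.List.Relation.Unary.All.Properties using (¬Any⇒All¬)
open import Data.List.Relation.Unary.AllPairs using (AllPairs; []; _∷_)
open import Data.List.Relation.Unary.Unique.Propositional using (Unique)
open import Data.List.Relation.Unary.Unique.Propositional.Properties using (allFin⁺; filter⁺)
open import Data.Nat using (ℕ; zero; suc; _+_; _*_; _∸_; _≤_; _<_; z≤n; s≤s; NonZero; >-nonZero⁻¹)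
open import Data.Nat.Properties hiding (_≟_)
open import Data.Nat.DivMod using (m*n/n≡m; /-monoˡ-≤)
open import Data.Product using (_×_; _,_; ∃-syntax; proj₁; proj₂)
open import Data.Sum using (_⊎_; inj₁; inj₂)
open import Data.Unit using (tt)
open import Function using (_∘_)
open import Relation.Nullary using (¬_; Dec; yes; no)
open import Relation.Nullary.Decidable using (_×-dec_; ¬?; decidable-stable)
open import Relation.Unary using (Decidable)
open import Relation.Binary.PropositionalEquality using (_≡_; _≢_; refl; sym; trans; cong; cong₂; subst)
open import Defs

count : {A : Set} → (A → Bool) → List A → ℕ
count f xs = length (filter (λ x → T? (f x)) xs)

module _ {A : Set} where

  count-mono : (f g : A → Bool) → (∀ x → T (f x) → T (g x)) →
               ∀ xs → count f xs ≤ count g xs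
  count-mono f g f⇒g [] = z≤n
  count-mono f g f⇒g (x ∷ xs) with f x | g x | f⇒g x
  ... | false | false | _   = count-mono f g f⇒g xs
  ... | false | true  | _   = m≤n⇒m≤1+n (count-mono f g f⇒g xs)
  ... | true  | true  | _   = s≤s (count-mono f g f⇒g xs)
  ... | true  | false | imp = ⊥-elim (imp tt)

  count-strict : (f g : A → Bool) → (∀ x → T (f x) → T (g x)) →
                 ∀ z xs → z ∈ xs → T (g z) → ¬ T (f z) → count f xs < count g xs
  count-strict f g f⇒g z (x ∷ xs) (here refl) gz ¬fz with f x | g x | f⇒g x
  ... | true  | _     | _ = ⊥-elim (¬fz tt)
  ... | false | true  | _ = s≤s (count-mono f g f⇒g xs)
  ... | false | false | _ = ⊥-elim gz
  count-strict f g f⇒g z (x ∷ xs) (there z∈) gz ¬fz with f x | g x | f⇒g x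
  ... | false | false | _   = count-strict f g f⇒g z xs z∈ gz ¬fz
  ... | false | true  | _   = m≤n⇒m≤1+n (count-strict f g f⇒g z xs z∈ gz ¬fz)
  ... | true  | true  | _   = s≤s (count-strict f g f⇒g z xs z∈ gz ¬fz)
  ... | true  | false | imp = ⊥-elim (imp tt)

  count-∨ : (f g : A → Bool) → (∀ x → T (f x) → T (g x) → ⊥) →
            ∀ xs → count (λ x → f x ∨ g x) xs ≡ count f xs + count g xs
  count-∨ f g disjoint [] = refl
  count-∨ f g disjoint (x ∷ xs) with f x | g x | disjoint x
  ... | false | false | _  = count-∨ f g disjoint xs
  ... | false | true  | _  = trans (cong suc (count-∨ f g disjoint xs)) (sym (+-suc _ _))
  ... | true  | false | _  = cong suc (count-∨ f g disjoint xs)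
  ... | true  | true  | both = ⊥-elim (both tt tt)

  count-false : ∀ xs → count {A} (λ _ → false) xs ≡ 0
  count-false []       = refl
  count-false (x ∷ xs) = count-false xs

  count-true : ∀ xs → count {A} (λ _ → true) xs ≡ length xs
  count-true []       = refl
  count-true (x ∷ xs) = cong suc (count-true xs)

count-allFin-≤ : ∀ {n} (f : Fin n → Bool) → count f (allFin n) ≤ n
count-allFin-≤ {n} f =
  subst (count f (allFin n) ≤_) (trans (count-true (allFin n)) (length-tabulate (λ x → x)))
        (count-mono f (λ _ → true) (λ _ _ → tt) (allFin n))

count-allFin-< : ∀ {n} (f : Fin n → Bool) z → ¬ T (f z) → count f (allFin n) < n
count-allFin-< {n} f z ¬fz =
  subst (count f (allFin n) <_) (trans (count-true (allFin n)) (length-tabulate (λ x → x)))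
        (count-strict f (λ _ → true) (λ _ _ → tt) z (allFin n) (∈-allFin z) tt ¬fz)

≤⌈/⌉ : ∀ {m} N r .{{_ : NonZero r}} → m * r ≤ N + (r ∸ 1) → m ≤ ⌈ N / r ⌉
≤⌈/⌉ {m} N r p = subst (_≤ ⌈ N / r ⌉) (m*n/n≡m m r) (/-monoˡ-≤ r p)

*≤⇒≤⌈/⌉ : ∀ {m} N r .{{_ : NonZero r}} → m * r ≤ N → m ≤ ⌈ N / r ⌉
*≤⇒≤⌈/⌉ N r p = ≤⌈/⌉ N r (≤-trans p (m≤m+n N (r ∸ 1)))

*<⇒<⌈/⌉ : ∀ {m} N r .{{_ : NonZero r}} → m * r < N → m < ⌈ N / r ⌉
*<⇒<⌈/⌉ {m} N (suc r') p = ≤⌈/⌉ N (suc r') (begin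
  suc r' + m * suc r'   ≡⟨ +-suc r' (m * suc r') ⟨
  r' + suc (m * suc r') ≤⟨ +-monoʳ-≤ r' p ⟩
  r' + N                ≡⟨ +-comm r' N ⟩
  N + r'                ∎)
  where open ≤-Reasoning

gap-with-old-colours : ∀ {χ χ₂ m K} → χ₂ ≤ χ + 2 * m → m < K → χ₂ ∸ χ ≤ 2 * K ∸ 2
gap-with-old-colours {χ} {χ₂} {m} {suc K} χ₂≤ (s≤s m≤K) = begin
  χ₂ ∸ χ            ≤⟨ ∸-monoˡ-≤ χ χ₂≤ ⟩
  χ + 2 * m ∸ χ     ≡⟨ m+n∸m≡n χ (2 * m) ⟩
  2 * m             ≤⟨ *-monoʳ-≤ 2 m≤K ⟩
  2 * K             ≡⟨ cong (_∸ 2) (*-suc 2 K) ⟨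
  2 * suc K ∸ 2     ∎
  where open ≤-Reasoning

gap-without-old-colours : ∀ {χ χ₂ m K} → χ₂ ≤ 2 * m → m ≤ K → m ≡ 0 ⊎ 2 ≤ χ →
                          χ₂ ∸ χ ≤ 2 * K ∸ 2
gap-without-old-colours {χ} {χ₂} χ₂≤ m≤K (inj₁ refl) = ≤-trans (≤-trans (m∸n≤m χ₂ χ) χ₂≤) z≤n
gap-without-old-colours χ₂≤ m≤K (inj₂ 2≤χ) =
  ≤-trans (∸-mono χ₂≤ 2≤χ) (∸-monoˡ-≤ 2 (*-monoʳ-≤ 2 m≤K))

module Greedy {A : Set} {P : A → Set} (P? : Decidable P)
              {R : A → A → Set} (R? : ∀ x y → Dec (R x y)) where

  select : List A → List A
  select [] = []
  select (v ∷ vs) with P? v | Any.any? (R? v) (select vs)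
  ... | yes _ | no _ = v ∷ select vs
  ... | _     | _    = select vs

  select-satisfies : ∀ vs → All P (select vs)
  select-satisfies [] = []
  select-satisfies (v ∷ vs) with P? v | Any.any? (R? v) (select vs)
  ... | yes pv | no _  = pv ∷ select-satisfies vs
  ... | yes _  | yes _ = select-satisfies vs
  ... | no _   | _     = select-satisfies vs

  select-unrelated : ∀ vs → AllPairs (λ s t → ¬ R s t) (select vs)
  select-unrelated [] = []
  select-unrelated (v ∷ vs) with P? v | Any.any? (R? v) (select vs)
  ... | yes _ | no miss = ¬Any⇒All¬ (select vs) miss ∷ select-unrelated vs
  ... | yes _ | yes _   = select-unrelated vs
  ... | no _  | _       = select-unrelated vs

  select-maximal : (∀ v → R v v) → ∀ {v vs} → v ∈ vs → P v → Any (R v) (select vs)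
  select-maximal R-refl {v} {_ ∷ vs} (here refl) pv with P? v | Any.any? (R? v) (select vs)
  ... | yes _  | no _  = here (R-refl v)
  ... | yes _  | yes r = r
  ... | no ¬pv | _     = ⊥-elim (¬pv pv)
  select-maximal R-refl {v} {w ∷ vs} (there v∈) pv with P? w | Any.any? (R? w) (select vs)
  ... | yes _ | no _  = there (select-maximal R-refl v∈ pv)
  ... | yes _ | yes _ = select-maximal R-refl v∈ pv
  ... | no _  | _     = select-maximal R-refl v∈ pv

module _ {n : ℕ} (G : Graph n) where

  neighbours : Fin n → List (Fin n)
  neighbours v = filter (λ u → T? (adj G v u)) (allFin n)

  neighbours-adj : ∀ {v u} → u ∈ neighbours v → Adj G v u
  neighbours-adj = proj₂ ∘ ∈-filter⁻ (λ u → T? (adj G _ u)) {xs = allFin n}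

  some-neighbour : ∀ v → 1 ≤ degree G v → ∃[ u ] Adj G v u
  some-neighbour v d with neighbours v in e
  ... | u ∷ _ = u , neighbours-adj (subst (u ∈_) (sym e) (here refl))
  some-neighbour v () | []

  neighbour-avoiding : ∀ v → 2 ≤ degree G v → ∀ a → ∃[ w ] (Adj G v w × w ≢ a)
  neighbour-avoiding v d a with neighbours v in e
  ... | u ∷ w ∷ _ with u ≟ a
  ...   | no u≢a  = u , neighbours-adj (subst (u ∈_) (sym e) (here refl)) , u≢a
  ...   | yes refl = w , neighbours-adj (subst (w ∈_) (sym e) (there (here refl))) , u≢w ∘ sym
    where
    u≢w : u ≢ w
    u≢w with (u≢w ∷ _) ∷ _ ← subst Unique e (filter⁺ (λ u → T? (adj G v u)) (allFin⁺ n)) = u≢w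
  neighbour-avoiding v () a | []
  neighbour-avoiding v (s≤s ()) a | _ ∷ []

  ⊆-nbhd-reverse : ∀ {s v} → degree G s ≤ degree G v →
                   (∀ z → Adj G v z → Adj G s z) → ∀ z → Adj G s z → Adj G v z
  ⊆-nbhd-reverse {s} {v} deg N⊆ z sz with T? (adj G v z)
  ... | yes vz = vz
  ... | no ¬vz = ⊥-elim (≤⇒≯ deg (count-strict (adj G v) (adj G s) N⊆ z (allFin n) (∈-allFin z) sz ¬vz))

  Meet : Fin n → Fin n → Set
  Meet s t = ∃[ x ] (Adj G s x × Adj G t x)

  meet? : ∀ s t → Dec (Meet s t)
  meet? s t = any? (λ x → T? (adj G s x) ×-dec T? (adj G t x))

  Scattered : List (Fin n) → Set
  Scattered = AllPairs (λ s t → ¬ Meet s t)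

  Covered : List (Fin n) → Fin n → Set
  Covered S w = Any (λ s → Adj G s w) S

  owner-unique : ∀ {S s t x} → Scattered S → s ∈ S → t ∈ S → Adj G s x → Adj G t x → s ≡ t
  owner-unique _ (here refl) (here refl) _ _ = refl
  owner-unique {x = x} (apart ∷ _) (here refl) (there t∈) sx tx = ⊥-elim (All.lookup apart t∈ (x , sx , tx))
  owner-unique {x = x} (apart ∷ _) (there s∈) (here refl) sx tx = ⊥-elim (All.lookup apart s∈ (x , tx , sx))
  owner-unique (_ ∷ sc) (there s∈) (there t∈) sx tx = owner-unique sc s∈ t∈ sx tx

  count-covered : ∀ {r} → Regular r G → ∀ S → Scattered S →
                  count (λ w → any (λ s → adj G s w) S) (allFin n) ≡ length S * r
  count-covered reg [] _ = count-false (allFin n)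
  count-covered reg (s ∷ S) (apart ∷ sc) =
    trans (count-∨ (adj G s) (λ w → any (λ t → adj G t w) S) disjoint (allFin n))
          (cong₂ _+_ (reg s) (count-covered reg S sc))
    where
    disjoint : ∀ x → Adj G s x → T (any (λ t → adj G t x) S) → ⊥
    disjoint x sx cov with find (any⁻ (λ t → adj G t x) S cov)
    ... | t , t∈ , tx = All.lookup apart t∈ (x , sx , tx)

  scattered-≤ : ∀ {r} → Regular r G → ∀ S → Scattered S → length S * r ≤ n
  scattered-≤ reg S sc = subst (_≤ n) (count-covered reg S sc) (count-allFin-≤ _)

  scattered-< : ∀ {r} → Regular r G → ∀ S → Scattered S → ∀ w → ¬ Covered S w → length S * r < n
  scattered-< reg S sc w ¬cov =
    subst (_< n) (count-covered reg S sc) (count-allFin-< _ w (¬cov ∘ any⁻ (λ s → adj G s w) S))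

module _ {n k : ℕ} (G : Graph n) (c : Fin n → Fin k) where

  Colourful : Fin n → Set
  Colourful v = ∃[ x ] ∃[ y ] (Adj G v x × Adj G v y × c x ≢ c y)

  colourful? : ∀ v → Dec (Colourful v)
  colourful? v = any? (λ x → any? (λ y → T? (adj G v x) ×-dec T? (adj G v y) ×-dec ¬? (c x ≟ c y)))

  monochromatic : ∀ {s x y} → ¬ Colourful s → Adj G s x → Adj G s y → c x ≡ c y
  monochromatic {x = x} {y} mono sx sy = decidable-stable (c x ≟ c y) (λ ne → mono (x , y , sx , sy , ne))

  record MaximalScattered : Set where
    field
      family    : List (Fin n)
      scattered : Scattered G family
      mono      : All (¬_ ∘ Colourful) family
      meets     : ∀ v → ¬ Colourful v → Any (Meet G v) family

  -- It exists as soon as every vertex has a neighbour (so Meet is reflexive).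
  maximalScattered : (∀ v → ∃[ u ] Adj G v u) → MaximalScattered
  maximalScattered has-nbr = record
    { family    = select (allFin n)
    ; scattered = select-unrelated (allFin n)
    ; mono      = select-satisfies (allFin n)
    ; meets     = λ v mono-v → select-maximal meet-self (∈-allFin v) mono-v
    }
    where
    open Greedy (¬? ∘ colourful?) (meet? G)
    meet-self : ∀ v → Meet G v v
    meet-self v with has-nbr v
    ... | u , vu = u , vu , vu

edge⇒2≤colours : ∀ {n k} (G : Graph n) {c : Fin n → Fin k} {u v} →
                 ProperColoring G k c → Adj G u v → 2 ≤ k
edge⇒2≤colours {k = suc (suc _)} _ _ _ = s≤s (s≤s z≤n)
edge⇒2≤colours {k = suc zero} _ {c} {u} {v} proper uv with c u | c v | proper u v uv
... | zero | zero | ne = ⊥-elim (ne refl)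
edge⇒2≤colours {k = zero} _ {c} {u} _ _ with c u
... | ()

-- The class of the i-th chosen vertex s (counted from the end of the list)
-- gets the colours b + 2i and b + 2i + 1; the second colour ("shade 1") is
-- used for every neighbour of s other than its anchor.
module Recolouring {n : ℕ} (G : Graph n) (base : Fin n → ℕ) (b : ℕ)
                   (anchor : Fin n → Fin n) where

  shade : Fin n → Fin n → ℕ
  shade s w with w ≟ anchor s
  ... | yes _ = 0
  ... | no _  = 1

  shade≤1 : ∀ s w → shade s w ≤ 1
  shade≤1 s w with w ≟ anchor s
  ... | yes _ = z≤n
  ... | no _  = s≤s z≤n

  shade-anchor : ∀ s → shade s (anchor s) ≡ 0
  shade-anchor s with anchor s ≟ anchor s
  ... | yes _ = refl
  ... | no ne = ⊥-elim (ne refl)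

  shade-other : ∀ {s w} → w ≢ anchor s → shade s w ≡ 1
  shade-other {s} {w} w≢a with w ≟ anchor s
  ... | yes e = ⊥-elim (w≢a e)
  ... | no _  = refl

  recolour : List (Fin n) → Fin n → ℕ
  recolour []      w = base w
  recolour (s ∷ S) w = if adj G s w then b + (2 * length S + shade s w) else recolour S w

  recolour-here : ∀ {s w} S → Adj G s w → recolour (s ∷ S) w ≡ b + (2 * length S + shade s w)
  recolour-here {s} {w} S sw with adj G s w
  ... | true = refl

  recolour-there : ∀ {s w} S → ¬ Adj G s w → recolour (s ∷ S) w ≡ recolour S w
  recolour-there {s} {w} S ¬sw with adj G s w
  ... | true  = ⊥-elim (¬sw tt)
  ... | false = refl

  -- The colour of w is below b + 2|S| if w is covered or its base colour is below b.
  Fits : List (Fin n) → Fin n → Set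
  Fits S w = Covered G S w ⊎ base w < b

  fits-tail : ∀ {s w S} → ¬ Adj G s w → Fits (s ∷ S) w → Fits S w
  fits-tail ¬sw (inj₁ (here sw))  = ⊥-elim (¬sw sw)
  fits-tail ¬sw (inj₁ (there cov)) = inj₁ cov
  fits-tail ¬sw (inj₂ lt)          = inj₂ lt

  class-lower : ∀ m d → b + 2 * m ≤ b + (2 * m + d)
  class-lower m d = +-monoʳ-≤ b (m≤m+n (2 * m) d)

  class-upper : ∀ m {d} → d ≤ 1 → b + (2 * m + d) < b + 2 * suc m
  class-upper m {d} d≤1 = +-monoʳ-< b (begin-strict
    2 * m + d     <⟨ +-monoʳ-< (2 * m) (s≤s d≤1) ⟩
    2 * m + 2     ≡⟨ +-comm (2 * m) 2 ⟩
    2 + 2 * m     ≡⟨ *-suc 2 m ⟨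
    2 * suc m     ∎)
    where open ≤-Reasoning

  recolour-< : ∀ S w → Fits S w → recolour S w < b + 2 * length S
  recolour-< [] w (inj₂ lt) = subst (base w <_) (sym (+-identityʳ b)) lt
  recolour-< (s ∷ S) w fits with T? (adj G s w)
  ... | yes sw rewrite recolour-here S sw = class-upper (length S) (shade≤1 s w)
  ... | no ¬sw rewrite recolour-there S ¬sw =
    <-≤-trans (recolour-< S w (fits-tail ¬sw fits)) (+-monoʳ-≤ b (*-monoʳ-≤ 2 (n≤1+n (length S))))

  below-class : ∀ S z {d} → Fits S z → recolour S z < b + (2 * length S + d)
  below-class S z fz = <-≤-trans (recolour-< S z fz) (class-lower (length S) _)

  uncovered : ∀ {s z S} → ¬ Adj G s z → ¬ Covered G S z → ¬ Covered G (s ∷ S) z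
  uncovered ¬sz _   (here sz)   = ¬sz sz
  uncovered _   ¬cz (there cov) = ¬cz cov

  SameClass : List (Fin n) → Fin n → Fin n → Set
  SameClass S x y = ∃[ s ] (s ∈ S × Adj G s x × Adj G s y × shade s x ≡ shade s y)

  BothBase : List (Fin n) → Fin n → Fin n → Set
  BothBase S x y = ¬ Covered G S x × ¬ Covered G S y × base x ≡ base y

  collision : ∀ S x y → Fits S x → Fits S y → recolour S x ≡ recolour S y →
              SameClass S x y ⊎ BothBase S x y
  collision [] x y _ _ eq = inj₂ ((λ ()) , (λ ()) , eq)
  collision (s ∷ S) x y fx fy eq with T? (adj G s x) | T? (adj G s y)
  ... | yes sx | yes sy
    rewrite recolour-here S sx | recolour-here S sy =
      inj₁ (s , here refl , sx , sy , +-cancelˡ-≡ (2 * length S) _ _ (+-cancelˡ-≡ b _ _ eq))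
  ... | yes sx | no ¬sy
    rewrite recolour-here S sx | recolour-there S ¬sy =
      ⊥-elim (<-irrefl (sym eq) (below-class S y (fits-tail ¬sy fy)))
  ... | no ¬sx | yes sy
    rewrite recolour-there S ¬sx | recolour-here S sy =
      ⊥-elim (<-irrefl eq (below-class S x (fits-tail ¬sx fx)))
  ... | no ¬sx | no ¬sy
    rewrite recolour-there S ¬sx | recolour-there S ¬sy
    with collision S x y (fits-tail ¬sx fx) (fits-tail ¬sy fy) eq
  ...   | inj₁ (t , t∈ , same) = inj₁ (t , there t∈ , same)
  ...   | inj₂ (¬cx , ¬cy , e) = inj₂ (uncovered ¬sx ¬cx , uncovered ¬sy ¬cy , e)

dynColorable-from-ℕ : ∀ {n} (G : Graph n) k (col : Fin n → ℕ) → (∀ w → col w < k) →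
  (∀ u v → Adj G u v → col u ≢ col v) →
  (∀ v → 2 ≤ degree G v → ∃[ u ] ∃[ w ] (Adj G v u × Adj G v w × col u ≢ col w)) →
  DynColorable G k
dynColorable-from-ℕ G k col bound proper dynamic = colour , proper′ , dynamic′
  where
  colour : _ → Fin k
  colour w = fromℕ< (bound w)
  reflect : ∀ u w → colour u ≡ colour w → col u ≡ col w
  reflect u w eq = trans (sym (toℕ-fromℕ< (bound u))) (trans (cong toℕ eq) (toℕ-fromℕ< (bound w)))
  proper′ : ProperColoring G k colour
  proper′ u v uv = proper u v uv ∘ reflect u v
  dynamic′ : ∀ v → 2 ≤ degree G v → ∃[ u ] ∃[ w ] (Adj G v u × Adj G v w × colour u ≢ colour w)
  dynamic′ v d with dynamic v d
  ... | u , w , vu , vw , ne = u , w , vu , vw , ne ∘ reflect u w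

module DynamicRecolouring {n r : ℕ} (G : Graph n) (reg : Regular r G)
         {χ : ℕ} (c : Fin n → Fin χ) (proper : ProperColoring G χ c)
         (anchor : Fin n → Fin n) (anchor-adj : ∀ v → Adj G v (anchor v))
         (F : MaximalScattered G c) (b : ℕ)
         (fits : ∀ w → Covered G (MaximalScattered.family F) w ⊎ toℕ (c w) < b) where

  open MaximalScattered F
  open Recolouring G (toℕ ∘ c) b anchor

  -- New colours refine the old ones, so the recolouring is still proper.
  refines : ∀ x y → recolour family x ≡ recolour family y → c x ≡ c y
  refines x y eq with collision family x y (fits x) (fits y) eq
  ... | inj₁ (s , s∈ , sx , sy , _) = monochromatic G c (All.lookup mono s∈) sx sy
  ... | inj₂ (_ , _ , e)            = toℕ-injective e

  separated : ∀ {s x y} → s ∈ family → Adj G s x → ¬ Adj G s y →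
              recolour family x ≢ recolour family y
  separated {x = x} {y} s∈ sx ¬sy eq with collision family x y (fits x) (fits y) eq
  ... | inj₁ (t , t∈ , tx , ty , _) with owner-unique G scattered t∈ s∈ tx sx
  ...   | refl = ¬sy ty
  separated s∈ sx ¬sy eq | inj₂ (¬cx , _ , _) = ¬cx (lose s∈ sx)

  split : ∀ {s w} → s ∈ family → Adj G s w → w ≢ anchor s →
          recolour family (anchor s) ≢ recolour family w
  split {s} {w} s∈ sw w≢a eq with collision family (anchor s) w (fits _) (fits w) eq
  ... | inj₁ (t , t∈ , ta , tw , same) with owner-unique G scattered t∈ s∈ ta (anchor-adj s)
  ...   | refl = 0≢1+n (trans (sym (shade-anchor t)) (trans same (shade-other w≢a)))
  split s∈ sw w≢a eq | inj₂ (¬ca , _ , _) = ¬ca (lose s∈ (anchor-adj _))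

  -- A vertex v meeting the class of s sees two new colours:
  -- either N(v) leaves N(s), or by regularity N(v) = N(s) contains both shades.
  dynamic-meeting : ∀ {v s} → 2 ≤ degree G v → s ∈ family → Meet G v s →
    ∃[ u ] ∃[ w ] (Adj G v u × Adj G v w × recolour family u ≢ recolour family w)
  dynamic-meeting {v} {s} d s∈ (x , vx , sx)
    with any? (λ y → T? (adj G v y) ×-dec ¬? (T? (adj G s y)))
  ... | yes (y , vy , ¬sy) = x , y , vx , vy , separated s∈ sx ¬sy
  ... | no none with neighbour-avoiding G s (subst (2 ≤_) (trans (reg v) (sym (reg s))) d) (anchor s)
  ...   | w , sw , w≢a = anchor s , w , N[s]⊆N[v] _ (anchor-adj s) , N[s]⊆N[v] w sw , split s∈ sw w≢a
    where
    N[v]⊆N[s] : ∀ z → Adj G v z → Adj G s z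
    N[v]⊆N[s] z vz = decidable-stable (T? (adj G s z)) (λ ¬sz → none (z , vz , ¬sz))
    N[s]⊆N[v] : ∀ z → Adj G s z → Adj G v z
    N[s]⊆N[v] = ⊆-nbhd-reverse G (≤-reflexive (trans (reg s) (sym (reg v)))) N[v]⊆N[s]

  dynamic : ∀ v → 2 ≤ degree G v →
    ∃[ u ] ∃[ w ] (Adj G v u × Adj G v w × recolour family u ≢ recolour family w)
  dynamic v d with colourful? G c v
  ... | yes (x , y , vx , vy , cx≢cy) = x , y , vx , vy , cx≢cy ∘ refines x y
  ... | no mono-v with find (meets v mono-v)
  ...   | s , s∈ , meet = dynamic-meeting d s∈ meet

  dynColorable : DynColorable G (b + 2 * length family)
  dynColorable = dynColorable-from-ℕ G _ (recolour family)
    (λ w → recolour-< family w (fits w))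
    (λ u v uv → proper u v uv ∘ refines u v)
    dynamic

theorem7 : (n r : ℕ) .{{_ : NonZero r}} → (G : Graph n) → Regular r G →
    (χ χ₂ : ℕ) → IsChromaticNumber G χ → IsDynamicChromaticNumber G χ₂ →
    χ₂ ∸ χ ≤ 2 * ⌈ n / r ⌉ ∸ 2
theorem7 n r G reg χ χ₂ ((c , proper) , _) (_ , χ₂-least) = gap
  where
  has-nbr : ∀ v → ∃[ u ] Adj G v u
  has-nbr v = some-neighbour G v (subst (1 ≤_) (sym (reg v)) (>-nonZero⁻¹ r))

  anchor : Fin n → Fin n
  anchor = proj₁ ∘ has-nbr

  anchor-adj : ∀ v → Adj G v (anchor v)
  anchor-adj = proj₂ ∘ has-nbr

  F : MaximalScattered G c
  F = maximalScattered G c has-nbr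
  open MaximalScattered F
  open DynamicRecolouring G reg c proper anchor anchor-adj F using (dynColorable)

  -- Without the old colours, a nonempty family still forces χ ≥ 2.
  empty-or-two : ∀ S → length S ≡ 0 ⊎ 2 ≤ χ
  empty-or-two []      = inj₁ refl
  empty-or-two (s ∷ _) = inj₂ (edge⇒2≤colours G proper (anchor-adj s))

  covered? : ∀ w → Dec (Covered G family w)
  covered? w = Any.any? (λ s → T? (adj G s w)) family

  gap : χ₂ ∸ χ ≤ 2 * ⌈ n / r ⌉ ∸ 2
  gap with all? covered?
  ... | yes all-covered = gap-without-old-colours {χ} {m = length family}
          (χ₂-least _ (dynColorable 0 (inj₁ ∘ all-covered)))
          (*≤⇒≤⌈/⌉ n r (scattered-≤ G reg family scattered))
          (empty-or-two family)
  ... | no not-all with ¬∀⟶∃¬ n _ covered? not-all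
  ...   | w , ¬cov = gap-with-old-colours {χ} {m = length family}
          (χ₂-least _ (dynColorable χ (inj₂ ∘ toℕ<n ∘ c)))
          (*<⇒<⌈/⌉ n r (scattered-< G reg family scattered w ¬cov))
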